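{- Let $q$ be a prime power, let $s\ge 1$ and let $d_1,\dots,d_s$ be positive integers. Put $n=d_1+\cdots+d_s$, $\mu=\max\{d_1,\dots,d_s\}$, and for each integer $i\ge 1$ let $\nu_i=\#\{j\in\{1,\dots,s\}\mid d_j=i\}$. Let $$\Lambda=\mathbf{F}_{q^{d_1}}\times\cdots\times\mathbf{F}_{q^{d_s}},\qquad \Lambda_{\mathrm{ex}}=\mathbf{F}_{q^{d_1}}^{d_1}\times\cdots\times\mathbf{F}_{q^{d_s}}^{d_s},$$ let $\sigma$ denote the Frobenius map $\alpha\mapsto\alpha^q$ (on each of these fields), and let $\varphi:\Lambda\to\Lambda_{\mathrm{ex}}$ be the $\mathbf{F}_q$-linear map $$\varphi(x_1,\dots,x_s)=(x_1,\sigma x_1,\dots,\sigma^{d_1-1}x_1,\;x_2,\sigma x_2,\dots,\sigma^{d_2-1}x_2,\;\dots,\;x_s,\dots,\sigma^{d_s-1}x_s).$$ For a tuple of field elements, let $w(\cdot)$ denote its Hamming weight (number of nonzero components). Let $\mathbf{x}\in\Lambda$ and let $a$ be a positive integer such that $$\sum_{i=a+1}^{\mu} i\nu_i < w(\varphi(\mathbf{x}))\le \sum_{i=a}^{\mu} i\nu_i .$$ Then $$w(\mathbf{x})\;\ge\;\min\Big\{\#S \;\Big|\; S\subseteq\{1,\dots,s\},\ \sum_{i\in S} d_i\ge w(\varphi(\mathbf{x}))\Big\}\;=\;\left\lceil\frac{w(\varphi(\mathbf{x}))-\sum_{i=a+1}^{\mu}(i-a)\nu_i}{a}\right\rceil 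.$$
   Context: In the paper, $d_i=\deg P_i$ for pairwise distinct places $P_1,\dots,P_s$ of an algebraic function field $F/\mathbf{F}_q$ with full constant field $\mathbf{F}_q$; the statement depends only on the degrees. The Hamming weight of an element of $\Lambda$ counts nonzero components $x_i$ (each $x_i$ being one component), while that of an element of $\Lambda_{\mathrm{ex}}$ counts nonzero entries among all $n$ entries. -}

module Defs where

open import Level using (Level; _⊔_) renaming (suc to lsuc)
open import Data.Nat using (ℕ; zero; suc; _+_; _∸_; _^_; _≤_; NonZero; _/_) renaming (_⊔_ to _⊔ℕ_)
import Data.Nat
import Data.Fin
open import Data.Nat.Primality using (Prime)
open import Data.Bool using (Bool; true; false; if_then_else_)
open import Data.Fin using (Fin)
open import Data.Fin.Subset using (Subset; ∣_∣)
open import Data.Vec using (lookup)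
open import Data.Product using (Σ; ∃; _×_; _,_)
open import Relation.Nullary using (¬_; does)
open import Relation.Binary using (Decidable)
open import Relation.Binary.PropositionalEquality as ≡ using (_≡_)
open import Algebra.Bundles using (CommutativeRing; Semiring)
open import Function.Bundles using (Bijection)
import Algebra.Definitions.RawSemiring as RS

IsPrimePower : ℕ → Set
IsPrimePower q = Σ ℕ λ p → Σ ℕ λ k → Prime p × (1 ≤ k) × (q ≡ p ^ k)

-- Decidability of
-- equality is recorded explicitly (it holds automatically for finite fields) so that
-- Hamming weights can be computed.
record FiniteField (m : ℕ) (c ℓ : Level) : Set (lsuc (c ⊔ ℓ)) where
  field
    commRing : CommutativeRing c ℓ
  open CommutativeRing commRing public
  field
    0≉1     : ¬ (0# ≈ 1#)
    inverse : ∀ x → ¬ (x ≈ 0#) → ∃ λ y → (x * y) ≈ 1#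
    card    : Bijection setoid (≡.setoid (Fin m))
    _≈?_    : Decidable _≈_

  open RS (Semiring.rawSemiring semiring) public using () renaming (_^_ to _^ᶠ_)

  isNonzero : Carrier → Bool
  isNonzero x = if does (x ≈? 0#) then false else true

frob : ∀ {m c ℓ} (q : ℕ) (K : FiniteField m c ℓ) → FiniteField.Carrier K → FiniteField.Carrier K
frob q K x = FiniteField._^ᶠ_ K x q

frobIter : ∀ {m c ℓ} (q : ℕ) (K : FiniteField m c ℓ) → ℕ → FiniteField.Carrier K → FiniteField.Carrier K
frobIter q K zero    x = x
frobIter q K (suc k) x = frob q K (frobIter q K k x)

sumFin : (n : ℕ) → (Fin n → ℕ) → ℕ
sumFin zero    f = 0
sumFin (suc n) f = f Fin.zero + sumFin n (λ i → f (Fin.suc i))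

countFin : (n : ℕ) → (Fin n → Bool) → ℕ
countFin n P = sumFin n (λ i → if P i then 1 else 0)

maxFin : (n : ℕ) → (Fin n → ℕ) → ℕ
maxFin zero    f = 0
maxFin (suc n) f = f Fin.zero ⊔ℕ maxFin n (λ i → f (Fin.suc i))

-- Σ_{i = lo}^{hi} f i  (empty if hi < lo)
sumFromLen : ℕ → ℕ → (ℕ → ℕ) → ℕ
sumFromLen lo zero    f = 0
sumFromLen lo (suc n) f = f lo + sumFromLen (suc lo) n f

sumRange : ℕ → ℕ → (ℕ → ℕ) → ℕ
sumRange lo hi f = sumFromLen lo (suc hi ∸ lo) f

nu : (s : ℕ) → (Fin s → ℕ) → ℕ → ℕ
nu s d i = countFin s (λ j → does (d j Data.Nat.≟ i))

sumOver : (s : ℕ) → Subset s → (Fin s → ℕ) → ℕ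
sumOver s S d = sumFin s (λ j → if lookup S j then d j else 0)

ceilDiv : (N a : ℕ) → .{{_ : NonZero a}} → ℕ
ceilDiv N a = (N + (a ∸ 1)) / a

module _ {c ℓ : Level} (q s : ℕ) (d : Fin s → ℕ)
         (K : (j : Fin s) → FiniteField (q ^ d j) c ℓ) where

  Λ : Set c
  Λ = (j : Fin s) → FiniteField.Carrier (K j)

  Λex : Set c
  Λex = (j : Fin s) → Fin (d j) → FiniteField.Carrier (K j)

  φ : Λ → Λex
  φ x j k = frobIter q (K j) (Data.Fin.toℕ k) (x j)

  wΛ : Λ → ℕ
  wΛ x = countFin s (λ j → FiniteField.isNonzero (K j) (x j))

  wEx : Λex → ℕ
  wEx y = sumFin s (λ j → countFin (d j) (λ k → FiniteField.isNonzero (K j) (y j k)))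

IsMinCover : (s : ℕ) → (Fin s → ℕ) → ℕ → ℕ → Set
IsMinCover s d W m =
  (Σ (Subset s) λ S → (W ≤ sumOver s S d) × (∣ S ∣ ≡ m)) ×
  ((S : Subset s) → W ≤ sumOver s S d → m ≤ ∣ S ∣)

{-# OPTIONS --safe #-}
-- Frobenius is injective, so block j of φ x has d_j nonzero entries when x_j ≠ 0 and none
-- otherwise: W = w(φ x) = Σ_{x_j ≠ 0} d_j, and the support of x is itself a cover of W.
-- Every index contributes d_j ≤ a + (d_j ∸ a), so a cover S has W ≤ a·#S + B with
-- B = Σ_j (d_j ∸ a) = Σ_{i>a} (i − a) ν_i, i.e. #S ≥ ⌈(W − B)/a⌉.  The bound is attained by all j
-- with d_j > a plus ⌈(W − B)/a⌉ − #{j | d_j > a} indices with d_j = a: the lower hypothesis on W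
-- makes this number nonnegative and the upper one guarantees there are enough such indices.
module Submission where

open import Defs
open import Level using (Level)
open import Data.Nat using (ℕ; zero; suc; pred; _+_; _*_; _∸_; _^_; _/_; _%_; _≤_; _<_; _≥_;
  _≤?_; _≟_; z≤n; s≤s; NonZero)
open import Data.Nat.Properties
open import Data.Nat.DivMod using (m≡m%n+[m/n]*n; m%n<n; m<n*o⇒m/o<n)
open import Data.Nat.Primality using (prime⇒nonZero)
open import Algebra.Properties.CommutativeSemigroup +-commutativeSemigroup using (interchange)
open import Data.Bool using (Bool; true; false; if_then_else_; _∨_)
open import Data.Fin using (Fin; toℕ) renaming (zero to fzero; suc to fsuc)
open import Data.Fin.Subset using (Subset; ∣_∣)
open import Data.Vec using ([]; _∷_; lookup; tabulate)
open import Data.Vec.Properties using (lookup∘tabulate)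
open import Data.Product using (Σ; _×_; _,_; proj₁; proj₂)
open import Function using (_∘_; _⇔_; mk⇔)
open import Relation.Nullary using (¬_; Dec; yes; no; does; contradiction)
open import Relation.Nullary.Decidable using (dec-true; dec-false; does-⇔; decidable-stable)
open import Relation.Binary.PropositionalEquality
  using (_≡_; _≢_; refl; sym; trans; cong; cong₂; subst; module ≡-Reasoning)

does-elim : ∀ {p} {P : Set p} (P? : Dec P) (F : Bool → Set) →
  (P → F true) → (¬ P → F false) → F (does P?)
does-elim (yes p) F yes-case no-case = yes-case p
does-elim (no ¬p) F yes-case no-case = no-case ¬p

does≡true⇒ : ∀ {p} {P : Set p} (P? : Dec P) → does P? ≡ true → P
does≡true⇒ (yes p) _ = p

ceilDiv-minimal : ∀ N a k .{{_ : NonZero a}} → N ≤ k * a → ceilDiv N a ≤ k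
ceilDiv-minimal N a k N≤ka = ≤-pred (m<n*o⇒m/o<n
  (subst (N + pred a <_) (+-comm (k * a) a) (+-mono-≤-< N≤ka (m≤pred[n]⇒suc[m]≤n ≤-refl))))

ceilDiv-covers : ∀ N a .{{_ : NonZero a}} → N ≤ ceilDiv N a * a
ceilDiv-covers N a = +-cancelʳ-≤ (pred a) N (M / a * a) (begin
    N + pred a          ≡⟨ m≡m%n+[m/n]*n M a ⟩
    M % a + M / a * a   ≤⟨ +-monoˡ-≤ (M / a * a) (<⇒≤pred (m%n<n M a)) ⟩
    pred a + M / a * a  ≡⟨ +-comm (pred a) (M / a * a) ⟩
    M / a * a + pred a  ∎)
  where
    open ≤-Reasoning
    M = N + pred a

*≤⇒≤ceilDiv : ∀ N a k .{{_ : NonZero a}} → k * a ≤ N → k ≤ ceilDiv N a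
*≤⇒≤ceilDiv N a k ka≤N = *-cancelʳ-≤ k (ceilDiv N a) a (≤-trans ka≤N (ceilDiv-covers N a))

sumFin-cong : ∀ n {f g : Fin n → ℕ} → (∀ i → f i ≡ g i) → sumFin n f ≡ sumFin n g
sumFin-cong zero    f≗g = refl
sumFin-cong (suc n) f≗g = cong₂ _+_ (f≗g fzero) (sumFin-cong n (f≗g ∘ fsuc))

sumFin-mono : ∀ n {f g : Fin n → ℕ} → (∀ i → f i ≤ g i) → sumFin n f ≤ sumFin n g
sumFin-mono zero    f≤g = z≤n
sumFin-mono (suc n) f≤g = +-mono-≤ (f≤g fzero) (sumFin-mono n (f≤g ∘ fsuc))

sumFin-+ : ∀ n (f g : Fin n → ℕ) → sumFin n (λ i → f i + g i) ≡ sumFin n f + sumFin n g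
sumFin-+ zero    f g = refl
sumFin-+ (suc n) f g = trans (cong (f fzero + g fzero +_) (sumFin-+ n (f ∘ fsuc) (g ∘ fsuc)))
  (interchange (f fzero) (g fzero) (sumFin n (f ∘ fsuc)) (sumFin n (g ∘ fsuc)))

sumWhere : (n : ℕ) → (Fin n → Bool) → (Fin n → ℕ) → ℕ
sumWhere n h f = sumFin n (λ j → if h j then f j else 0)

if-∨ : ∀ b₁ b₂ v → (b₂ ≡ true → b₁ ≡ false) →
  (if b₁ ∨ b₂ then v else 0) ≡ (if b₁ then v else 0) + (if b₂ then v else 0)
if-∨ true  true  v disjoint = contradiction (disjoint refl) λ ()
if-∨ true  false v disjoint = sym (+-identityʳ v)
if-∨ false b₂    v disjoint = refl

sumWhere-∨ : ∀ n (h₁ h₂ : Fin n → Bool) f → (∀ j → h₂ j ≡ true → h₁ j ≡ false) →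
  sumWhere n (λ j → h₁ j ∨ h₂ j) f ≡ sumWhere n h₁ f + sumWhere n h₂ f
sumWhere-∨ n h₁ h₂ f disjoint =
  trans (sumFin-cong n (λ j → if-∨ (h₁ j) (h₂ j) (f j) (disjoint j))) (sumFin-+ n _ _)

sumWhere-constOn : ∀ n (h : Fin n → Bool) f k → (∀ j → h j ≡ true → f j ≡ k) →
  sumWhere n h f ≡ countFin n h * k
sumWhere-constOn zero    h f k f≡k = refl
sumWhere-constOn (suc n) h f k f≡k with h fzero in h₀
... | true  = cong₂ _+_ (f≡k fzero h₀) (sumWhere-constOn n (h ∘ fsuc) (f ∘ fsuc) k (f≡k ∘ fsuc))
... | false = sumWhere-constOn n (h ∘ fsuc) (f ∘ fsuc) k (f≡k ∘ fsuc)

countFin-const : ∀ n b → countFin n (λ _ → b) ≡ (if b then n else 0)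
countFin-const zero    true  = refl
countFin-const zero    false = refl
countFin-const (suc n) true  = cong suc (countFin-const n true)
countFin-const (suc n) false = countFin-const n false

∣S∣≡countFin : ∀ {n} (S : Subset n) → ∣ S ∣ ≡ countFin n (lookup S)
∣S∣≡countFin []          = refl
∣S∣≡countFin (true ∷ S)  = cong suc (∣S∣≡countFin S)
∣S∣≡countFin (false ∷ S) = ∣S∣≡countFin S

∣tabulate∣ : ∀ n (h : Fin n → Bool) → ∣ tabulate h ∣ ≡ countFin n h
∣tabulate∣ n h = trans (∣S∣≡countFin (tabulate h))
  (sumFin-cong n (λ j → cong (λ b → if b then 1 else 0) (lookup∘tabulate h j)))

sumOver-tabulate : ∀ n (h : Fin n → Bool) f → sumOver n (tabulate h) f ≡ sumWhere n h f
sumOver-tabulate n h f = sumFin-cong n (λ j → cong (λ b → if b then f j else 0) (lookup∘tabulate h j))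

≤-maxFin : ∀ n (f : Fin n → ℕ) j → f j ≤ maxFin n f
≤-maxFin (suc n) f fzero    = m≤m⊔n (f fzero) (maxFin n (f ∘ fsuc))
≤-maxFin (suc n) f (fsuc j) =
  ≤-trans (≤-maxFin n (f ∘ fsuc) j) (m≤n⊔m (f fzero) (maxFin n (f ∘ fsuc)))

firstMembers : (n : ℕ) → ℕ → (Fin n → Bool) → Fin n → Bool
firstMembers (suc n) zero    h j        = false
firstMembers (suc n) (suc c) h fzero    = h fzero
firstMembers (suc n) (suc c) h (fsuc j) = firstMembers n (if h fzero then c else suc c) (h ∘ fsuc) j

firstMembers⊆ : ∀ n c h j → firstMembers n c h j ≡ true → h j ≡ true
firstMembers⊆ (suc n) (suc c) h fzero    chosen = chosen
firstMembers⊆ (suc n) (suc c) h (fsuc j) chosen = firstMembers⊆ n _ (h ∘ fsuc) j chosen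

countFin-firstMembers : ∀ n c h → c ≤ countFin n h → countFin n (firstMembers n c h) ≡ c
countFin-firstMembers zero    zero    h c≤ = refl
countFin-firstMembers (suc n) zero    h c≤ = countFin-const n false
countFin-firstMembers (suc n) (suc c) h c≤ with h fzero
... | true  = cong suc (countFin-firstMembers n c (h ∘ fsuc) (≤-pred c≤))
... | false = countFin-firstMembers n (suc c) (h ∘ fsuc) c≤

sumFromLen-cong : ∀ lo len {f g : ℕ → ℕ} → (∀ i → f i ≡ g i) →
  sumFromLen lo len f ≡ sumFromLen lo len g
sumFromLen-cong lo zero      f≗g = refl
sumFromLen-cong lo (suc len) f≗g = cong₂ _+_ (f≗g lo) (sumFromLen-cong (suc lo) len f≗g)

sumFromLen-+ : ∀ lo len (f g : ℕ → ℕ) →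
  sumFromLen lo len (λ i → f i + g i) ≡ sumFromLen lo len f + sumFromLen lo len g
sumFromLen-+ lo zero      f g = refl
sumFromLen-+ lo (suc len) f g = trans (cong (f lo + g lo +_) (sumFromLen-+ (suc lo) len f g))
  (interchange (f lo) (g lo) (sumFromLen (suc lo) len f) (sumFromLen (suc lo) len g))

sumFromLen-≡0 : ∀ lo len (f : ℕ → ℕ) → (∀ i → lo ≤ i → f i ≡ 0) → sumFromLen lo len f ≡ 0
sumFromLen-≡0 lo zero      f f≡0 = refl
sumFromLen-≡0 lo (suc len) f f≡0 =
  cong₂ _+_ (f≡0 lo ≤-refl) (sumFromLen-≡0 (suc lo) len f (λ i lo<i → f≡0 i (<⇒≤ lo<i)))

sumFromLen-point : ∀ lo len (f : ℕ → ℕ) v → lo ≤ v → v < lo + len →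
  (∀ i → i ≢ v → f i ≡ 0) → sumFromLen lo len f ≡ f v
sumFromLen-point lo zero f v lo≤v v<lo+0 f≡0 =
  contradiction lo≤v (<⇒≱ (subst (v <_) (+-identityʳ lo) v<lo+0))
sumFromLen-point lo (suc len) f v lo≤v v<lo+len f≡0 with lo ≟ v
... | yes refl = trans (cong (f lo +_) (sumFromLen-≡0 (suc lo) len f (λ i lo<i → f≡0 i (>⇒≢ lo<i))))
                       (+-identityʳ (f lo))
... | no lo≢v  = cong₂ _+_ (f≡0 lo lo≢v)
  (sumFromLen-point (suc lo) len f v (≤∧≢⇒< lo≤v lo≢v) (subst (v <_) (+-suc lo len) v<lo+len) f≡0)

sumRange-point : ∀ lo hi (f : ℕ → ℕ) v → v ≤ hi → (∀ i → i ≢ v → f i ≡ 0) →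
  sumRange lo hi f ≡ (if does (lo ≤? v) then f v else 0)
sumRange-point lo hi f v v≤hi f≡0 =
  does-elim (lo ≤? v) (λ b → sumRange lo hi f ≡ (if b then f v else 0))
    (λ lo≤v → sumFromLen-point lo (suc hi ∸ lo) f v lo≤v
      (subst (v <_) (sym (m+[n∸m]≡n (≤-trans lo≤v (m≤n⇒m≤1+n v≤hi)))) (s≤s v≤hi)) f≡0)
    (λ lo≰v → sumFromLen-≡0 lo (suc hi ∸ lo) f
      (λ i lo≤i → f≡0 i (λ i≡v → lo≰v (subst (lo ≤_) i≡v lo≤i))))

sumRange-nu : ∀ s (d : Fin s → ℕ) (g : ℕ → ℕ) lo hi → (∀ j → d j ≤ hi) →
  sumRange lo hi (λ i → g i * nu s d i) ≡ sumWhere s (λ j → does (lo ≤? d j)) (g ∘ d)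
sumRange-nu zero    d g lo hi d≤hi = sumFromLen-≡0 lo (suc hi ∸ lo) _ (λ i _ → *-zeroʳ (g i))
sumRange-nu (suc s) d g lo hi d≤hi = begin
    sumFromLen lo L (λ i → g i * (δ i + nu s (d ∘ fsuc) i))
      ≡⟨ sumFromLen-cong lo L (λ i → *-distribˡ-+ (g i) (δ i) _) ⟩
    sumFromLen lo L (λ i → g i * δ i + g i * nu s (d ∘ fsuc) i)
      ≡⟨ sumFromLen-+ lo L _ _ ⟩
    sumRange lo hi (λ i → g i * δ i) + sumRange lo hi (λ i → g i * nu s (d ∘ fsuc) i)
      ≡⟨ cong₂ _+_ head-term (sumRange-nu s (d ∘ fsuc) g lo hi (d≤hi ∘ fsuc)) ⟩
    sumWhere (suc s) (λ j → does (lo ≤? d j)) (g ∘ d) ∎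
  where
    open ≡-Reasoning
    L v : ℕ
    L = suc hi ∸ lo
    v = d fzero
    δ : ℕ → ℕ
    δ i = if does (v ≟ i) then 1 else 0
    off-v : ∀ i → i ≢ v → g i * δ i ≡ 0
    off-v i i≢v = trans (cong (λ b → g i * (if b then 1 else 0)) (dec-false (v ≟ i) (i≢v ∘ sym)))
                        (*-zeroʳ (g i))
    at-v : g v * δ v ≡ g v
    at-v = trans (cong (λ b → g v * (if b then 1 else 0)) (dec-true (v ≟ v) refl)) (*-identityʳ (g v))
    head-term : sumRange lo hi (λ i → g i * δ i) ≡ (if does (lo ≤? v) then g v else 0)
    head-term = trans (sumRange-point lo hi (λ i → g i * δ i) v (d≤hi fzero) off-v)
                      (cong (λ t → if does (lo ≤? v) then t else 0) at-v)

module Cover (s : ℕ) (d : Fin s → ℕ) (a : ℕ) .{{_ : NonZero a}} where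

  atLeast : ℕ → Fin s → Bool
  atLeast lo j = does (lo ≤? d j)

  equalsA : Fin s → Bool
  equalsA j = does (d j ≟ a)

  -- With truncated subtraction this is Σ_{i > a} (i - a) ν_i.
  excess : ℕ
  excess = sumFin s (λ j → d j ∸ a)

  sumWhere-≤ : ∀ h → sumWhere s h d ≤ excess + countFin s h * a
  sumWhere-≤ h = begin
      sumWhere s h d
        ≤⟨ sumFin-mono s (λ j → bound (h j) (d j)) ⟩
      sumFin s (λ j → (d j ∸ a) + (if h j then a else 0))
        ≡⟨ sumFin-+ s _ _ ⟩
      excess + sumWhere s h (λ _ → a)
        ≡⟨ cong (excess +_) (sumWhere-constOn s h _ a (λ _ _ → refl)) ⟩
      excess + countFin s h * a ∎
    where
      open ≤-Reasoning
      bound : ∀ b v → (if b then v else 0) ≤ (v ∸ a) + (if b then a else 0)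
      bound true  v = subst (v ≤_) (+-comm a (v ∸ a)) (m≤n+m∸n v a)
      bound false v = z≤n

  sumWhere-atLeast : ∀ lo → a ≤ lo → lo ≤ suc a →
    sumWhere s (atLeast lo) d ≡ excess + countFin s (atLeast lo) * a
  sumWhere-atLeast lo a≤lo lo≤1+a = begin
      sumWhere s (atLeast lo) d
        ≡⟨ sumFin-cong s (λ j → split (d j)) ⟩
      sumFin s (λ j → (d j ∸ a) + (if atLeast lo j then a else 0))
        ≡⟨ sumFin-+ s _ _ ⟩
      excess + sumWhere s (atLeast lo) (λ _ → a)
        ≡⟨ cong (excess +_) (sumWhere-constOn s (atLeast lo) _ a (λ _ _ → refl)) ⟩
      excess + countFin s (atLeast lo) * a ∎
    where
      open ≡-Reasoning
      split : ∀ v → (if does (lo ≤? v) then v else 0) ≡ (v ∸ a) + (if does (lo ≤? v) then a else 0)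
      split v = does-elim (lo ≤? v) (λ b → (if b then v else 0) ≡ (v ∸ a) + (if b then a else 0))
        (λ lo≤v → sym (m∸n+n≡m (≤-trans a≤lo lo≤v)))
        (λ lo≰v → sym (trans (+-identityʳ (v ∸ a))
                             (m≤n⇒m∸n≡0 (≤-pred (≤-trans (≰⇒> lo≰v) lo≤1+a)))))

  atLeast-a : ∀ j → atLeast a j ≡ atLeast (suc a) j ∨ equalsA j
  atLeast-a j = does-elim (suc a ≤? d j) (λ b → atLeast a j ≡ b ∨ equalsA j)
    (λ a<dj → dec-true (a ≤? d j) (<⇒≤ a<dj))
    (λ a≮dj → does-⇔ (mk⇔ (λ a≤dj → ≤-antisym (≮⇒≥ a≮dj) a≤dj) (≤-reflexive ∘ sym))
                      (a ≤? d j) (d j ≟ a))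

  equalsA⇒¬atLeast-suc : ∀ j → equalsA j ≡ true → atLeast (suc a) j ≡ false
  equalsA⇒¬atLeast-suc j isA =
    dec-false (suc a ≤? d j) (λ a<dj → <-irrefl (sym (does≡true⇒ (d j ≟ a) isA)) a<dj)

  cover-lowerBound : ∀ W (S : Subset s) → W ≤ sumOver s S d → ceilDiv (W ∸ excess) a ≤ ∣ S ∣
  cover-lowerBound W S covers = subst (ceilDiv (W ∸ excess) a ≤_) (sym (∣S∣≡countFin S))
    (ceilDiv-minimal (W ∸ excess) a _ (m≤n+o⇒m∸n≤o W excess (≤-trans covers (sumWhere-≤ (lookup S)))))

  cover-construct : ∀ W → sumWhere s (atLeast (suc a)) d ≤ W → W ≤ sumWhere s (atLeast a) d →
    Σ (Subset s) λ S → W ≤ sumOver s S d × ∣ S ∣ ≡ ceilDiv (W ∸ excess) a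
  cover-construct W lower upper = tabulate chosen , covers , size
    where
      m N : ℕ
      m = ceilDiv (W ∸ excess) a
      N = countFin s (atLeast (suc a))

      N≤m : N ≤ m
      N≤m = *≤⇒≤ceilDiv (W ∸ excess) a N (m+n≤o⇒m≤o∸n (N * a) (begin
        N * a + excess  ≡⟨ +-comm (N * a) excess ⟩
        excess + N * a  ≡⟨ sumWhere-atLeast (suc a) (n≤1+n a) ≤-refl ⟨
        sumWhere s (atLeast (suc a)) d ≤⟨ lower ⟩
        W ∎))
        where open ≤-Reasoning

      m≤N+E : m ≤ N + countFin s equalsA
      m≤N+E = ceilDiv-minimal (W ∸ excess) a _ (m≤n+o⇒m∸n≤o W excess (begin
        W                                         ≤⟨ upper ⟩
        sumWhere s (atLeast a) d                  ≡⟨ sumWhere-atLeast a ≤-refl (n≤1+n a) ⟩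
        excess + countFin s (atLeast a) * a       ≡⟨ cong (λ k → excess + k * a) countFin-atLeast-a ⟩
        excess + (N + countFin s equalsA) * a     ∎))
        where
          open ≤-Reasoning
          countFin-atLeast-a : countFin s (atLeast a) ≡ N + countFin s equalsA
          countFin-atLeast-a = trans (sumFin-cong s (λ j → cong (λ b → if b then 1 else 0) (atLeast-a j)))
            (sumWhere-∨ s (atLeast (suc a)) equalsA (λ _ → 1) equalsA⇒¬atLeast-suc)

      extra chosen : Fin s → Bool
      extra = firstMembers s (m ∸ N) equalsA
      chosen j = atLeast (suc a) j ∨ extra j

      extra⇒equalsA : ∀ j → extra j ≡ true → equalsA j ≡ true
      extra⇒equalsA = firstMembers⊆ s (m ∸ N) equalsA

      extra-disjoint : ∀ j → extra j ≡ true → atLeast (suc a) j ≡ false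
      extra-disjoint j = equalsA⇒¬atLeast-suc j ∘ extra⇒equalsA j

      N+#extra≡m : N + countFin s extra ≡ m
      N+#extra≡m = trans (cong (N +_) (countFin-firstMembers s (m ∸ N) equalsA (m≤n+o⇒m∸n≤o m N m≤N+E)))
                         (m+[n∸m]≡n N≤m)

      size : ∣ tabulate chosen ∣ ≡ m
      size = trans (∣tabulate∣ s chosen)
        (trans (sumWhere-∨ s (atLeast (suc a)) extra (λ _ → 1) extra-disjoint) N+#extra≡m)

      sum-chosen : sumOver s (tabulate chosen) d ≡ excess + m * a
      sum-chosen = begin
        sumOver s (tabulate chosen) d
          ≡⟨ sumOver-tabulate s chosen d ⟩
        sumWhere s chosen d
          ≡⟨ sumWhere-∨ s (atLeast (suc a)) extra d extra-disjoint ⟩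
        sumWhere s (atLeast (suc a)) d + sumWhere s extra d
          ≡⟨ cong₂ _+_ (sumWhere-atLeast (suc a) (n≤1+n a) ≤-refl)
                       (sumWhere-constOn s extra d a (λ j → does≡true⇒ (d j ≟ a) ∘ extra⇒equalsA j)) ⟩
        excess + N * a + countFin s extra * a
          ≡⟨ +-assoc excess (N * a) _ ⟩
        excess + (N * a + countFin s extra * a)
          ≡⟨ cong (excess +_) (*-distribʳ-+ a N (countFin s extra)) ⟨
        excess + (N + countFin s extra) * a
          ≡⟨ cong (λ k → excess + k * a) N+#extra≡m ⟩
        excess + m * a ∎
        where open ≡-Reasoning

      covers : W ≤ sumOver s (tabulate chosen) d
      covers = begin
        W                      ≤⟨ m≤n+m∸n W excess ⟩
        excess + (W ∸ excess)  ≤⟨ +-monoʳ-≤ excess (ceilDiv-covers (W ∸ excess) a) ⟩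
        excess + m * a         ≡⟨ sum-chosen ⟨
        sumOver s (tabulate chosen) d ∎
        where open ≤-Reasoning

  sumRange-i*nu : ∀ lo → sumRange lo (maxFin s d) (λ i → i * nu s d i) ≡ sumWhere s (atLeast lo) d
  sumRange-i*nu lo = sumRange-nu s d (λ i → i) lo (maxFin s d) (≤-maxFin s d)

  sumRange-excess : sumRange (suc a) (maxFin s d) (λ i → (i ∸ a) * nu s d i) ≡ excess
  sumRange-excess = trans (sumRange-nu s d (_∸ a) (suc a) (maxFin s d) (≤-maxFin s d))
    (sumFin-cong s (λ j → does-elim (suc a ≤? d j) (λ b → (if b then d j ∸ a else 0) ≡ d j ∸ a)
      (λ _ → refl) (λ a≮dj → sym (m≤n⇒m∸n≡0 (≮⇒≥ a≮dj)))))

  sumRange-from-a+1 : ∀ f → sumRange (a + 1) (maxFin s d) f ≡ sumRange (suc a) (maxFin s d) f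
  sumRange-from-a+1 f = cong (λ lo → sumRange lo (maxFin s d) f) (+-comm a 1)

  isMinCover : ∀ W → sumRange (a + 1) (maxFin s d) (λ i → i * nu s d i) ≤ W →
    W ≤ sumRange a (maxFin s d) (λ i → i * nu s d i) →
    IsMinCover s d W (ceilDiv (W ∸ sumRange (a + 1) (maxFin s d) (λ i → (i ∸ a) * nu s d i)) a)
  isMinCover W lower upper =
    subst (λ B → IsMinCover s d W (ceilDiv (W ∸ B) a)) (sym (trans (sumRange-from-a+1 _) sumRange-excess))
      ( cover-construct W (subst (_≤ W) (trans (sumRange-from-a+1 _) (sumRange-i*nu (suc a))) lower)
                          (subst (W ≤_) (sumRange-i*nu a) upper)
      , cover-lowerBound W)

module _ {m c ℓ} (K : FiniteField m c ℓ) where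
  open FiniteField K using (_≈_; _≈?_; 0#; 1#; _^ᶠ_; isNonzero; inverse; 0≉1)
  module K = FiniteField K

  nonzero-* : ∀ {x y} → ¬ x ≈ 0# → ¬ y ≈ 0# → ¬ (x K.* y) ≈ 0#
  nonzero-* {x} {y} x≉0 y≉0 xy≈0 = y≉0 (begin
      y                    ≈⟨ K.*-identityˡ y ⟨
      1# K.* y             ≈⟨ K.*-congʳ (K.trans (K.*-comm x⁻¹ x) x*x⁻¹≈1) ⟨
      x⁻¹ K.* x K.* y      ≈⟨ K.*-assoc x⁻¹ x y ⟩
      x⁻¹ K.* (x K.* y)    ≈⟨ K.*-congˡ xy≈0 ⟩
      x⁻¹ K.* 0#           ≈⟨ K.zeroʳ x⁻¹ ⟩
      0#                   ∎)
    where
      open import Relation.Binary.Reasoning.Setoid K.setoid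
      x⁻¹ : K.Carrier
      x⁻¹ = proj₁ (inverse x x≉0)
      x*x⁻¹≈1 : (x K.* x⁻¹) ≈ 1#
      x*x⁻¹≈1 = proj₂ (inverse x x≉0)

  nonzero-^ : ∀ {x} n → ¬ x ≈ 0# → ¬ (x ^ᶠ n) ≈ 0#
  nonzero-^ zero    x≉0 1≈0 = 0≉1 (K.sym 1≈0)
  nonzero-^ (suc n) x≉0     = nonzero-* x≉0 (nonzero-^ n x≉0)

  ^≈0⇔≈0 : ∀ {x} n → 0 < n → (x ^ᶠ n) ≈ 0# ⇔ x ≈ 0#
  ^≈0⇔≈0 {x} (suc n) _ = mk⇔
    (λ xⁿ≈0 → decidable-stable (x ≈? 0#) (λ x≉0 → nonzero-^ (suc n) x≉0 xⁿ≈0))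
    (λ x≈0 → K.trans (K.*-congʳ x≈0) (K.zeroˡ (x ^ᶠ n)))

  isNonzero-frobIter : ∀ {q} → 0 < q → ∀ k x → isNonzero (frobIter q K k x) ≡ isNonzero x
  isNonzero-frobIter q>0 zero    x = refl
  isNonzero-frobIter q>0 (suc k) x = trans
    (cong (λ b → if b then false else true) (does-⇔ (^≈0⇔≈0 _ q>0) (_ ≈? 0#) (_ ≈? 0#)))
    (isNonzero-frobIter q>0 k x)

module _ {c ℓ} (q s : ℕ) (d : Fin s → ℕ) (K : (j : Fin s) → FiniteField (q ^ d j) c ℓ) where

  support : Λ q s d K → Subset s
  support x = tabulate (λ j → FiniteField.isNonzero (K j) (x j))

  wΛ≡∣support∣ : ∀ x → wΛ q s d K x ≡ ∣ support x ∣
  wΛ≡∣support∣ x = sym (∣tabulate∣ s _)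

  wEx∘φ≡sumOver-support : 0 < q → ∀ x → wEx q s d K (φ q s d K x) ≡ sumOver s (support x) d
  wEx∘φ≡sumOver-support q>0 x = trans
    (sumFin-cong s λ j → trans
      (sumFin-cong (d j) (λ k →
        cong (λ b → if b then 1 else 0) (isNonzero-frobIter (K j) q>0 (toℕ k) (x j))))
      (countFin-const (d j) (FiniteField.isNonzero (K j) (x j))))
    (sym (sumOver-tabulate s _ d))

primePower>0 : ∀ {q} → IsPrimePower q → 0 < q
primePower>0 (p , k , p-prime , _ , refl) = m^n>0 p {{prime⇒nonZero p-prime}} k

proposition1 : {c ℓ : Level} (q : ℕ) → IsPrimePower q →
    (s : ℕ) → 1 ≤ s → (d : Fin s → ℕ) → ((j : Fin s) → 1 ≤ d j) →
    (K : (j : Fin s) → FiniteField (q ^ d j) c ℓ) →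
    (x : Λ q s d K) → (a : ℕ) → .{{_ : NonZero a}} →
    sumRange (a + 1) (maxFin s d) (λ i → i * nu s d i) < wEx q s d K (φ q s d K x) →
    wEx q s d K (φ q s d K x) ≤ sumRange a (maxFin s d) (λ i → i * nu s d i) →
    Σ ℕ λ m → IsMinCover s d (wEx q s d K (φ q s d K x)) m
      × wΛ q s d K x ≥ m
      × m ≡ ceilDiv (wEx q s d K (φ q s d K x)
                     ∸ sumRange (a + 1) (maxFin s d) (λ i → (i ∸ a) * nu s d i)) a
proposition1 q q-primePower s _ d _ K x a lower upper =
  m , minCover , subst (m ≤_) (sym (wΛ≡∣support∣ q s d K x)) support-covers , refl
  where
    W m : ℕ
    W = wEx q s d K (φ q s d K x)
    m = ceilDiv (W ∸ sumRange (a + 1) (maxFin s d) (λ i → (i ∸ a) * nu s d i)) a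

    minCover : IsMinCover s d W m
    minCover = Cover.isMinCover s d a W (<⇒≤ lower) upper

    support-covers : m ≤ ∣ support q s d K x ∣
    support-covers = proj₂ minCover (support q s d K x)
      (≤-reflexive (wEx∘φ≡sumOver-support q s d K (primePower>0 q-primePower) x))
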